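{- Let $\mathcal{BIP}$ be the class of bipartite graphs. For all integers $j\geq 20$ and for $j \in \{15,16,17\}$, we have $R_{1}^{\mathcal{BIP}}(4,j)=2j-1$.
   Context: All graphs are finite and simple. For a graph $G$ and an integer $k\ge 0$, a $k$-sparse $j$-set is a set of exactly $j$ vertices of $G$ inducing a subgraph of maximum degree at most $k$; a $k$-dense $i$-set is a set of exactly $i$ vertices that is $k$-sparse in the complement of $G$. For a graph class $\mathcal{G}$, $R_k^{\mathcal{G}}(i,j)$ is the smallest natural number $n$ such that every graph on $n$ vertices in $\mathcal{G}$ has a $k$-dense $i$-set or a $k$-sparse $j$-set. -}

module Defs where

open import Data.Nat using (ℕ; zero; suc; _≤_; _<_)
open import Data.Bool using (Bool; true; false; not; _∧_; if_then_else_)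
open import Data.Fin using (Fin; _≟_)
open import Data.List using (List; map; allFin)
open import Data.Nat.ListAction using (sum)
open import Data.Product using (Σ; _×_; ∃)
open import Data.Sum using (_⊎_)
open import Function.Definitions using (Injective)
open import Relation.Binary.PropositionalEquality using (_≡_; _≢_)
open import Relation.Nullary using (¬_)
open import Relation.Nullary.Decidable using (⌊_⌋)

record Graph (n : ℕ) : Set where
  field
    adj   : Fin n → Fin n → Bool
    sym   : ∀ u v → adj u v ≡ adj v u
    irrefl : ∀ v → adj v v ≡ false
open Graph public

complement : ∀ {n} → Graph n → Graph n
complement {n} G = record { adj = cadj ; sym = csym ; irrefl = cirr }
  where
  cadj : Fin n → Fin n → Bool
  cadj u v = not (adj G u v) ∧ not ⌊ u ≟ v ⌋
  open import Relation.Binary.PropositionalEquality using (refl; sym; cong₂)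
  open import Relation.Nullary using (yes; no)
  csym : ∀ u v → cadj u v ≡ cadj v u
  csym u v with u ≟ v | v ≟ u
  ... | yes refl | yes _ = refl
  ... | yes refl | no q = Data.Empty.⊥-elim (q refl)
    where import Data.Empty
  ... | no p | yes refl = Data.Empty.⊥-elim (p refl)
    where import Data.Empty
  ... | no _ | no _ rewrite Graph.sym G u v = refl
  cirr : ∀ v → cadj v v ≡ false
  cirr v with v ≟ v
  ... | yes _ = Data.Bool.Properties.∧-zeroʳ (not (adj G v v))
    where import Data.Bool.Properties
  ... | no q = Data.Empty.⊥-elim (q refl)
    where import Data.Empty

Bipartite : ∀ {n} → Graph n → Set
Bipartite {n} G = Σ (Fin n → Bool) λ c → ∀ u v → adj G u v ≡ true → c u ≢ c v

boolToℕ : Bool → ℕ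
boolToℕ b = if b then 1 else 0

-- A j-set of vertices is given by an injective map f : Fin j → Fin n.
-- Degree of the a-th vertex of the set inside the induced subgraph.
inducedDeg : ∀ {n j} → Graph n → (Fin j → Fin n) → Fin j → ℕ
inducedDeg {j = j} G f a = sum (map (λ b → boolToℕ (adj G (f a) (f b))) (allFin j))

SparseSet : ∀ {n} → ℕ → (j : ℕ) → Graph n → Set
SparseSet {n} k j G =
  Σ (Fin j → Fin n) λ f → Injective _≡_ _≡_ f × (∀ a → inducedDeg G f a ≤ k)

DenseSet : ∀ {n} → ℕ → (i : ℕ) → Graph n → Set
DenseSet k i G = SparseSet k i (complement G)

RamseyPropBIP : ℕ → ℕ → ℕ → ℕ → Set
RamseyPropBIP k i j n =
  (G : Graph n) → Bipartite G → DenseSet k i G ⊎ SparseSet k j G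

RamseyBIP≡ : ℕ → ℕ → ℕ → ℕ → Set
RamseyBIP≡ k i j r = RamseyPropBIP k i j r × (∀ m → m < r → ¬ RamseyPropBIP k i j m)

-- Upper bound: a bipartite graph on 2j - 1 vertices has a colour class with at least j
-- vertices, and a colour class is independent.
--
-- Lower bound: in a 1-dense 4-set every member misses at most one other member, so two
-- nonadjacent members would have the remaining two as common neighbours.  In a graph in
-- which distinct vertices have at most one common neighbour a 1-dense 4-set is therefore a
-- clique, which a bipartite graph does not contain.  It remains to find, for t = j - 1, such
-- a bipartite graph on 2t vertices without 1-sparse (t+1)-sets; its induced subgraphs handle
-- all smaller orders.  Disjoint unions of the incidence graphs of the Fano plane (t = 7), of
-- the Möbius–Kantor configuration (t = 8), of PG(2,3) (t = 13) and of PG(2,3) minus a flag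
-- (t = 12) do the job: the bound on their 1-sparse sets is checked by exhaustive search, and
-- every t ∈ {14, 15, 16} and every t ≥ 19 is a sum of 7s, 8s, 12s and 13s.
module Submission where

open import Defs hiding (sym; irrefl)
open import Algebra.Properties.CommutativeSemigroup using (interchange)
open import Data.Bool using (Bool; true; false; not; _∧_; _∨_; if_then_else_; T)
open import Data.Bool.ListAction using (any)
open import Data.Bool.Properties using (∧-identityʳ; T-≡; T-∨; T-∧) renaming (_≟_ to _≟ᵇ_)
open import Data.Empty using (⊥; ⊥-elim)
open import Data.Fin using (Fin; zero; suc; toℕ; _≟_; inject≤; splitAt; join; #_)
open import Data.Fin.Properties using (inject≤-injective; toℕ<n; toℕ-injective; join-splitAt)
open import Data.List using (List; []; _∷_; _++_; map; length; allFin; upTo; filter; lookup)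
open import Data.List.Membership.Propositional using (_∈_)
open import Data.List.Membership.Propositional.Properties
  using (∈-allFin; ∈-lookup; ∈-++⁺ˡ; ∈-++⁺ʳ; ∈-filter⁺; ∈-filter⁻; ∈-upTo⁺)
open import Data.List.Membership.Propositional.Properties.WithK using (unique∧set⇒bag)
open import Data.List.Properties
  using (map-++; map-∘; map-cong; length-map; length-tabulate; filter-all)
open import Data.List.Relation.Binary.BagAndSetEquality using (∼bag⇒↭)
open import Data.List.Relation.Binary.Permutation.Propositional using (_↭_; ↭-sym)
open import Data.List.Relation.Binary.Permutation.Propositional.Properties
  using (All-resp-↭; shift; ↭-length) renaming (map⁺ to ↭-map⁺)
open import Data.List.Relation.Binary.Sublist.Propositional using (_⊆_; _∷_; _∷ʳ_)
open import Data.List.Relation.Binary.Sublist.Propositional.Properties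
  using (filter-⊆; filter⁺; length-mono-≤)
open import Data.List.Relation.Unary.All as All using (All; all?)
open import Data.List.Relation.Unary.All.Properties using (all-filter) renaming (map⁺ to All-map⁺)
open import Data.List.Relation.Unary.Any using (here; there)
open import Data.List.Relation.Unary.Unique.Propositional using (Unique; []; _∷_)
open import Data.List.Relation.Unary.Unique.Propositional.Properties
  using (allFin⁺; upTo⁺) renaming (map⁺ to Unique-map⁺; filter⁺ to Unique-filter⁺)
import Data.Nat as ℕ
open import Data.Nat
  using (ℕ; zero; suc; _+_; _*_; _∸_; _%_; _≤_; _<_; z≤n; s≤s; _≤?_; _<ᵇ_; _≡ᵇ_; NonZero)
open import Data.Nat.ListAction using (sum)
open import Data.Nat.ListAction.Properties using (sum-++; sum-↭)
open import Data.Nat.Properties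
  using ( ≤-refl; ≤-reflexive; ≤-trans; <-≤-trans; ≤-pred; n≤0⇒n≡0; 1+n≰n; ≤⇒≯; ≰⇒>
        ; m≤m+n; m≤n+m; +-suc; +-comm; +-identityʳ; +-mono-≤; +-monoʳ-≤; +-monoʳ-<
        ; m+n∸m≡n; m+[n∸m]≡n; <⇒<ᵇ; <ᵇ⇒<; +-commutativeSemigroup; module ≤-Reasoning )
open import Data.Product using (Σ-syntax; _×_; _,_; proj₂)
open import Data.Sum using (_⊎_; inj₁; inj₂; [_,_]; swap) renaming (map to ⊎-map)
open import Data.Sum.Properties using (inj₁-injective; inj₂-injective; swap-involutive)
open import Function using (_∘_; const)
open import Function.Bundles using (Equivalence; mk⇔)
open import Function.Definitions using (Injective)
open import Relation.Binary.Definitions using (DecidableEquality)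
open import Relation.Binary.PropositionalEquality hiding ([_])
open import Relation.Nullary using (¬_; Dec; yes; no; ¬?; _×-dec_; _→-dec_)
open import Relation.Nullary.Decidable using (⌊_⌋; toWitness; dec-false; isYes≗does)

-- Degrees inside lists of vertices

module _ {V : Set} (adj : V → V → Bool) where

  degree : List V → V → ℕ
  degree ys x = sum (map (λ y → boolToℕ (adj x y)) ys)

  Sparse : ℕ → List V → Set
  Sparse k ys = All (λ x → degree ys x ≤ k) ys

  CommonNeighbourUnique : Set
  CommonNeighbourUnique = ∀ {u w b d} → u ≢ w →
    adj u b ≡ true → adj w b ≡ true → adj u d ≡ true → adj w d ≡ true → b ≡ d

  degree-++ : ∀ xs ys x → degree (xs ++ ys) x ≡ degree xs x + degree ys x
  degree-++ xs ys x =
    trans (cong sum (map-++ _ xs ys)) (sum-++ (map (λ y → boolToℕ (adj x y)) xs) _)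

  degree-↭ : ∀ {xs ys} → xs ↭ ys → ∀ x → degree xs x ≡ degree ys x
  degree-↭ xs↭ys x = sum-↭ (↭-map⁺ _ xs↭ys)

  Sparse-↭ : ∀ {k xs ys} → xs ↭ ys → Sparse k xs → Sparse k ys
  Sparse-↭ {k} xs↭ys sparse =
    All-resp-↭ xs↭ys (All.map (λ {x} → subst (_≤ k) (degree-↭ xs↭ys x)) sparse)

module _ {V W : Set} {adjV : V → V → Bool} {adjW : W → W → Bool} (f : V → W)
         (f-adj : ∀ u v → adjW (f u) (f v) ≡ adjV u v) where

  degree-map : ∀ ys x → degree adjW (map f ys) (f x) ≡ degree adjV ys x
  degree-map ys x =
    cong sum (trans (sym (map-∘ ys)) (map-cong (λ y → cong boolToℕ (f-adj x y)) ys))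

  Sparse-map : ∀ {k ys} → Sparse adjV k ys → Sparse adjW k (map f ys)
  Sparse-map {k} {ys} sparse =
    All-map⁺ (All.map (λ {x} → subst (_≤ k) (sym (degree-map ys x))) sparse)

module _ {A : Set} (g : A → Bool) where

  1≤sum-boolToℕ : ∀ {x xs} → x ∈ xs → g x ≡ true → 1 ≤ sum (map (boolToℕ ∘ g) xs)
  1≤sum-boolToℕ (here refl) gx rewrite gx = s≤s z≤n
  1≤sum-boolToℕ {xs = y ∷ _} (there x∈) gx =
    ≤-trans (1≤sum-boolToℕ x∈ gx) (m≤n+m _ (boolToℕ (g y)))

  2≤sum-boolToℕ : ∀ {x y xs} → x ≢ y → x ∈ xs → y ∈ xs → g x ≡ true → g y ≡ true →
                  2 ≤ sum (map (boolToℕ ∘ g) xs)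
  2≤sum-boolToℕ x≢y (here refl) (here refl) _  _  = ⊥-elim (x≢y refl)
  2≤sum-boolToℕ x≢y (here refl) (there y∈)  gx gy rewrite gx = s≤s (1≤sum-boolToℕ y∈ gy)
  2≤sum-boolToℕ x≢y (there x∈)  (here refl) gx gy rewrite gy = s≤s (1≤sum-boolToℕ x∈ gx)
  2≤sum-boolToℕ {xs = z ∷ _} x≢y (there x∈) (there y∈) gx gy =
    ≤-trans (2≤sum-boolToℕ x≢y x∈ y∈ gx gy) (m≤n+m _ (boolToℕ (g z)))

sum-map-zero : ∀ {A : Set} (g : A → ℕ) xs → (∀ x → g x ≡ 0) → sum (map g xs) ≡ 0
sum-map-zero g []       _   = refl
sum-map-zero g (x ∷ xs) g≡0 rewrite g≡0 x = sum-map-zero g xs g≡0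

lookup-injective : ∀ {A : Set} {xs : List A} → Unique xs → ∀ i k → lookup xs i ≡ lookup xs k → i ≡ k
lookup-injective {xs = _ ∷ _} _ zero zero _ = refl
lookup-injective {xs = _ ∷ _} (x∉ ∷ _) zero    (suc k) eq = ⊥-elim (All.lookup x∉ (∈-lookup k) eq)
lookup-injective {xs = _ ∷ _} (x∉ ∷ _) (suc i) zero    eq = ⊥-elim (All.lookup x∉ (∈-lookup i) (sym eq))
lookup-injective {xs = _ ∷ _} (_ ∷ unique) (suc i) (suc k) eq =
  cong suc (lookup-injective unique i k eq)

∈-length≤1 : ∀ {A : Set} {xs : List A} {x y} → length xs ≤ 1 → x ∈ xs → y ∈ xs → x ≡ y
∈-length≤1 {xs = _ ∷ []}    _         (here refl) (here refl) = refl
∈-length≤1 {xs = _ ∷ _ ∷ _} (s≤s ()) _           _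

-- Sparse and dense sets of graphs

sparseSet⇒sparseList : ∀ {n k j} (G : Graph n) → SparseSet k j G →
  Σ[ ys ∈ List (Fin n) ] Unique ys × Sparse (adj G) k ys × length ys ≡ j
sparseSet⇒sparseList {j = j} G (f , f-injective , deg≤k) =
  map f (allFin j) ,
  Unique-map⁺ f-injective (allFin⁺ j) ,
  Sparse-map f (λ _ _ → refl) (All.tabulate (λ {a} _ → deg≤k a)) ,
  trans (length-map f (allFin j)) (length-tabulate _)

complement-adj : ∀ {n} (G : Graph n) {u v} → u ≢ v → adj (complement G) u v ≡ not (adj G u v)
complement-adj G {u} {v} u≢v =
  trans (cong (λ b → not (adj G u v) ∧ not b) (trans (isYes≗does (u ≟ v)) (dec-false (u ≟ v) u≢v)))
        (∧-identityʳ _)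

module OneDenseSet {n j} (G : Graph n) (f : Fin j → Fin n) (f-injective : Injective _≡_ _≡_ f)
                   (deg≤1 : ∀ a → inducedDeg (complement G) f a ≤ 1) where

  private
    f-distinct : ∀ {a b} → a ≢ b → f a ≢ f b
    f-distinct a≢b = a≢b ∘ f-injective

  nonneighbour-unique : ∀ {a b c} → b ≢ a → c ≢ a → b ≢ c →
                        adj G (f a) (f b) ≡ false → adj G (f a) (f c) ≡ true
  nonneighbour-unique {a} {b} {c} b≢a c≢a b≢c fab with adj G (f a) (f c) in fac
  ... | true  = refl
  ... | false = ⊥-elim (≤⇒≯ (deg≤1 a)
        (2≤sum-boolToℕ (λ x → adj (complement G) (f a) (f x)) b≢c (∈-allFin b) (∈-allFin c)
          (complement-adjacent b≢a fab) (complement-adjacent c≢a fac)))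
    where
    complement-adjacent : ∀ {x} → x ≢ a → adj G (f a) (f x) ≡ false →
                          adj (complement G) (f a) (f x) ≡ true
    complement-adjacent x≢a fax = trans (complement-adj G (f-distinct (x≢a ∘ sym))) (cong not fax)

  adjacent : CommonNeighbourUnique (adj G) →
    ∀ {a b k l} → a ≢ b → a ≢ k → a ≢ l → b ≢ k → b ≢ l → k ≢ l → adj G (f a) (f b) ≡ true
  adjacent common {a} {b} {k} {l} a≢b a≢k a≢l b≢k b≢l k≢l with adj G (f a) (f b) in fab
  ... | true  = refl
  ... | false = ⊥-elim (k≢l (f-injective (common (f-distinct a≢b)
        (nonneighbour-unique (a≢b ∘ sym) (a≢k ∘ sym) b≢k fab)
        (nonneighbour-unique a≢b (b≢k ∘ sym) a≢k fba)
        (nonneighbour-unique (a≢b ∘ sym) (a≢l ∘ sym) b≢l fab)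
        (nonneighbour-unique a≢b (b≢l ∘ sym) a≢l fba))))
    where
    fba : adj G (f b) (f a) ≡ false
    fba = trans (Graph.sym G (f b) (f a)) fab

no-three-distinct-Bools : ∀ (x y z : Bool) → x ≢ y → y ≢ z → x ≢ z → ⊥
no-three-distinct-Bools true  true  _     x≢y _   _   = x≢y refl
no-three-distinct-Bools false false _     x≢y _   _   = x≢y refl
no-three-distinct-Bools true  false true  _   _   x≢z = x≢z refl
no-three-distinct-Bools true  false false _   y≢z _   = y≢z refl
no-three-distinct-Bools false true  true  _   y≢z _   = y≢z refl
no-three-distinct-Bools false true  false _   _   x≢z = x≢z refl

¬denseSet-1-4 : ∀ {n} (G : Graph n) → Bipartite G → CommonNeighbourUnique (adj G) → ¬ DenseSet 1 4 G
¬denseSet-1-4 G (c , proper) common (f , f-injective , deg≤1) =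
  no-three-distinct-Bools (c (f (# 0))) (c (f (# 1))) (c (f (# 2)))
    (proper _ _ (adjacent common {# 0} {# 1} {# 2} {# 3} (λ ()) (λ ()) (λ ()) (λ ()) (λ ()) (λ ())))
    (proper _ _ (adjacent common {# 1} {# 2} {# 0} {# 3} (λ ()) (λ ()) (λ ()) (λ ()) (λ ()) (λ ())))
    (proper _ _ (adjacent common {# 0} {# 2} {# 1} {# 3} (λ ()) (λ ()) (λ ()) (λ ()) (λ ()) (λ ())))
  where open OneDenseSet G f f-injective deg≤1

module _ {n} (G : Graph n) (c : Fin n → Bool) (proper : ∀ u v → adj G u v ≡ true → c u ≢ c v) where

  colourClass : Bool → List (Fin n)
  colourClass b = filter (λ x → c x ≟ᵇ b) (allFin n)

  colourClass-sparseSet : ∀ {k j} b → j ≤ length (colourClass b) → SparseSet k j G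
  colourClass-sparseSet b j≤ = f , f-injective , λ a → ≤-trans (≤-reflexive (deg≡0 a)) z≤n
    where
    f = λ a → lookup (colourClass b) (inject≤ a j≤)
    f-injective = λ {a} {a′} eq → inject≤-injective j≤ j≤ a a′
      (lookup-injective (Unique-filter⁺ _ (allFin⁺ n)) _ _ eq)
    colour-f : ∀ a → c (f a) ≡ b
    colour-f a = All.lookup (all-filter _ (allFin n)) (∈-lookup (inject≤ a j≤))
    nonadjacent : ∀ a a′ → adj G (f a) (f a′) ≡ false
    nonadjacent a a′ with adj G (f a) (f a′) in faa′
    ... | false = refl
    ... | true  = ⊥-elim (proper _ _ faa′ (trans (colour-f a) (sym (colour-f a′))))
    deg≡0 : ∀ a → inducedDeg G f a ≡ 0
    deg≡0 a = sum-map-zero _ (allFin _) (λ a′ → cong boolToℕ (nonadjacent a a′))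

  colourClass-sizes : length (colourClass true) + length (colourClass false) ≡ n
  colourClass-sizes = trans (split (allFin n)) (length-tabulate _)
    where
    split : ∀ xs → length (filter (λ x → c x ≟ᵇ true) xs) + length (filter (λ x → c x ≟ᵇ false) xs)
                   ≡ length xs
    split [] = refl
    split (x ∷ xs) with c x
    ... | true  = cong suc (split xs)
    ... | false = trans (+-suc _ _) (cong suc (split xs))

  largeColourClass-sparseSet : ∀ {k j} → j + j ≤ suc n → SparseSet k j G
  largeColourClass-sparseSet {j = j} 2j≤1+n
    with j ≤? length (colourClass true) | j ≤? length (colourClass false)
  ... | yes j≤ | _      = colourClass-sparseSet true j≤
  ... | no _   | yes j≤ = colourClass-sparseSet false j≤
  ... | no j≰a | no j≰b = ⊥-elim (1+n≰n (begin
        2 + n           ≡⟨ cong (2 +_) colourClass-sizes ⟨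
        2 + (a + b)     ≡⟨ cong (1 +_) (+-suc a b) ⟨
        suc a + suc b   ≤⟨ +-mono-≤ (≰⇒> j≰a) (≰⇒> j≰b) ⟩
        j + j           ≤⟨ 2j≤1+n ⟩
        suc n           ∎))
    where
    open ≤-Reasoning
    a = length (colourClass true)
    b = length (colourClass false)

bipartite-sparseSet : ∀ {n k j} (G : Graph n) → Bipartite G → j + j ≤ suc n → SparseSet k j G
bipartite-sparseSet G (c , proper) = largeColourClass-sparseSet G c proper

-- Lower-bound graphs

record LowerBoundGraph (t : ℕ) : Set₁ where
  field
    Vertex                  : Set
    edge                    : Vertex → Vertex → Bool
    edge-sym                : ∀ u v → edge u v ≡ edge v u
    edge-irrefl             : ∀ v → edge v v ≡ false
    colour                  : Vertex → Bool
    colour-proper           : ∀ u v → edge u v ≡ true → colour u ≢ colour v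
    common-neighbour-unique : CommonNeighbourUnique edge
    sparse-bound            : ∀ {ys} → Unique ys → Sparse edge 1 ys → length ys ≤ t
    order                   : ℕ
    t+t≤order               : t + t ≤ order
    embed                   : Fin order → Vertex
    embed-injective         : Injective _≡_ _≡_ embed

module InducedGraph {t} (H : LowerBoundGraph t) {m} (m≤order : m ≤ LowerBoundGraph.order H) where
  open LowerBoundGraph H

  vertex : Fin m → Vertex
  vertex u = embed (inject≤ u m≤order)

  vertex-injective : Injective _≡_ _≡_ vertex
  vertex-injective = inject≤-injective m≤order m≤order _ _ ∘ embed-injective

  graph : Graph m
  graph = record
    { adj    = λ u v → edge (vertex u) (vertex v)
    ; sym    = λ u v → edge-sym (vertex u) (vertex v)
    ; irrefl = λ v → edge-irrefl (vertex v)
    }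

  graph-bipartite : Bipartite graph
  graph-bipartite = colour ∘ vertex , λ u v → colour-proper (vertex u) (vertex v)

  graph-common-neighbour-unique : CommonNeighbourUnique (adj graph)
  graph-common-neighbour-unique u≢w ub wb ud wd =
    vertex-injective (common-neighbour-unique (u≢w ∘ vertex-injective) ub wb ud wd)

  graph-sparseSet-size : ∀ {j} → SparseSet 1 j graph → j ≤ t
  graph-sparseSet-size sparseSet
    with ys , ys-unique , ys-sparse , refl ← sparseSet⇒sparseList graph sparseSet =
    subst (_≤ t) (length-map vertex ys) (sparse-bound
      (Unique-map⁺ vertex-injective ys-unique) (Sparse-map vertex (λ _ _ → refl) ys-sparse))

2[1+t]∸1≡1+2t : ∀ t → 2 * suc t ∸ 1 ≡ suc (t + t)
2[1+t]∸1≡1+2t t = trans (cong (λ m → t + suc m) (+-identityʳ t)) (+-suc t t)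

lowerBoundGraph⇒ramseyBIP : ∀ {t} → LowerBoundGraph t → RamseyBIP≡ 1 4 (suc t) (2 * suc t ∸ 1)
lowerBoundGraph⇒ramseyBIP {t} H rewrite 2[1+t]∸1≡1+2t t = upper , lower
  where
  upper : RamseyPropBIP 1 4 (suc t) (suc (t + t))
  upper G bipartite = inj₂ (bipartite-sparseSet G bipartite (≤-reflexive (cong suc (+-suc t t))))
  lower : ∀ m → m < suc (t + t) → ¬ RamseyPropBIP 1 4 (suc t) m
  lower m m<1+2t ramsey =
    [ ¬denseSet-1-4 graph graph-bipartite graph-common-neighbour-unique
    , 1+n≰n ∘ graph-sparseSet-size
    ] (ramsey graph graph-bipartite)
    where open InducedGraph H (≤-trans (≤-pred m<1+2t) (LowerBoundGraph.t+t≤order H))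

-- Disjoint unions

module _ {A B : Set} where

  _⊎-adj_ : (A → A → Bool) → (B → B → Bool) → A ⊎ B → A ⊎ B → Bool
  (adjA ⊎-adj adjB) (inj₁ x) (inj₁ y) = adjA x y
  (adjA ⊎-adj adjB) (inj₂ x) (inj₂ y) = adjB x y
  (adjA ⊎-adj adjB) _        _        = false

  lefts : List (A ⊎ B) → List A
  lefts []            = []
  lefts (inj₁ x ∷ ys) = x ∷ lefts ys
  lefts (inj₂ _ ∷ ys) = lefts ys

  ∈-lefts⁻ : ∀ {x ys} → x ∈ lefts ys → inj₁ x ∈ ys
  ∈-lefts⁻ {ys = inj₁ _ ∷ _} (here refl) = here refl
  ∈-lefts⁻ {ys = inj₁ _ ∷ _} (there x∈)  = there (∈-lefts⁻ x∈)
  ∈-lefts⁻ {ys = inj₂ _ ∷ _} x∈          = there (∈-lefts⁻ x∈)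

  Unique-lefts : ∀ {ys} → Unique ys → Unique (lefts ys)
  Unique-lefts {[]}         []             = []
  Unique-lefts {inj₁ x ∷ _} (x∉ ∷ unique) =
    All.tabulate (λ y∈ x≡y → All.lookup x∉ (∈-lefts⁻ y∈) (cong inj₁ x≡y)) ∷ Unique-lefts unique
  Unique-lefts {inj₂ _ ∷ _} (_ ∷ unique)  = Unique-lefts unique

  module _ (adjA : A → A → Bool) (adjB : B → B → Bool) where

    degree-lefts : ∀ ys x → degree (adjA ⊎-adj adjB) ys (inj₁ x) ≡ degree adjA (lefts ys) x
    degree-lefts []            x = refl
    degree-lefts (inj₁ y ∷ ys) x = cong (boolToℕ (adjA x y) +_) (degree-lefts ys x)
    degree-lefts (inj₂ y ∷ ys) x = degree-lefts ys x

    Sparse-lefts : ∀ {k ys} → Sparse (adjA ⊎-adj adjB) k ys → Sparse adjA k (lefts ys)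
    Sparse-lefts {k} {ys} sparse =
      All.tabulate (λ {x} x∈ → subst (_≤ k) (degree-lefts ys x) (All.lookup sparse (∈-lefts⁻ x∈)))

-- The B-vertices of ys are the lefts of map swap ys, so the lemmas on lefts serve both sides.
length-lefts+rights : ∀ {A B : Set} (ys : List (A ⊎ B)) →
                      length ys ≡ length (lefts ys) + length (lefts (map swap ys))
length-lefts+rights []            = refl
length-lefts+rights (inj₁ _ ∷ ys) = cong suc (length-lefts+rights ys)
length-lefts+rights (inj₂ _ ∷ ys) = trans (cong suc (length-lefts+rights ys)) (sym (+-suc _ _))

⊎-adj-swap : ∀ {A B : Set} (adjA : A → A → Bool) (adjB : B → B → Bool) u v →
             (adjB ⊎-adj adjA) (swap u) (swap v) ≡ (adjA ⊎-adj adjB) u v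
⊎-adj-swap adjA adjB (inj₁ _) (inj₁ _) = refl
⊎-adj-swap adjA adjB (inj₁ _) (inj₂ _) = refl
⊎-adj-swap adjA adjB (inj₂ _) (inj₁ _) = refl
⊎-adj-swap adjA adjB (inj₂ _) (inj₂ _) = refl

swap-injective : ∀ {A B : Set} → Injective _≡_ _≡_ (swap {A = A} {B = B})
swap-injective {x = x} {y} eq =
  trans (sym (swap-involutive x)) (trans (cong swap eq) (swap-involutive y))

⊎-map-injective : ∀ {A B C D : Set} {f : A → C} {g : B → D} →
  Injective _≡_ _≡_ f → Injective _≡_ _≡_ g → Injective _≡_ _≡_ (⊎-map f g)
⊎-map-injective f-inj g-inj {inj₁ _} {inj₁ _} eq = cong inj₁ (f-inj (inj₁-injective eq))
⊎-map-injective f-inj g-inj {inj₂ _} {inj₂ _} eq = cong inj₂ (g-inj (inj₂-injective eq))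
⊎-map-injective f-inj g-inj {inj₁ _} {inj₂ _} ()
⊎-map-injective f-inj g-inj {inj₂ _} {inj₁ _} ()

splitAt-injective : ∀ m {n} → Injective _≡_ _≡_ (splitAt m {n})
splitAt-injective m {n} {i} {j} eq =
  trans (sym (join-splitAt m n i)) (trans (cong (join m n) eq) (join-splitAt m n j))

_⊕_ : ∀ {t₁ t₂} → LowerBoundGraph t₁ → LowerBoundGraph t₂ → LowerBoundGraph (t₁ + t₂)
_⊕_ {t₁} {t₂} H₁ H₂ = record
  { Vertex                  = H₁.Vertex ⊎ H₂.Vertex
  ; edge                    = edge
  ; edge-sym                = edge-sym
  ; edge-irrefl             = [ H₁.edge-irrefl , H₂.edge-irrefl ]
  ; colour                  = colour
  ; colour-proper           = colour-proper
  ; common-neighbour-unique = common-neighbour-unique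
  ; sparse-bound            = sparse-bound
  ; order                   = H₁.order + H₂.order
  ; t+t≤order               = ≤-trans (≤-reflexive (interchange +-commutativeSemigroup t₁ t₂ t₁ t₂))
                                      (+-mono-≤ H₁.t+t≤order H₂.t+t≤order)
  ; embed                   = ⊎-map H₁.embed H₂.embed ∘ splitAt H₁.order
  ; embed-injective         = splitAt-injective H₁.order
                              ∘ ⊎-map-injective H₁.embed-injective H₂.embed-injective
  }
  where
  module H₁ = LowerBoundGraph H₁
  module H₂ = LowerBoundGraph H₂

  edge : H₁.Vertex ⊎ H₂.Vertex → H₁.Vertex ⊎ H₂.Vertex → Bool
  edge = H₁.edge ⊎-adj H₂.edge

  edge-sym : ∀ u v → edge u v ≡ edge v u
  edge-sym (inj₁ x) (inj₁ y) = H₁.edge-sym x y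
  edge-sym (inj₁ _) (inj₂ _) = refl
  edge-sym (inj₂ _) (inj₁ _) = refl
  edge-sym (inj₂ x) (inj₂ y) = H₂.edge-sym x y

  colour : H₁.Vertex ⊎ H₂.Vertex → Bool
  colour = [ H₁.colour , H₂.colour ]

  colour-proper : ∀ u v → edge u v ≡ true → colour u ≢ colour v
  colour-proper (inj₁ x) (inj₁ y) = H₁.colour-proper x y
  colour-proper (inj₂ x) (inj₂ y) = H₂.colour-proper x y

  common-neighbour-unique : CommonNeighbourUnique edge
  common-neighbour-unique {inj₁ _} {inj₁ _} {inj₁ _} {inj₁ _} u≢w ub wb ud wd =
    cong inj₁ (H₁.common-neighbour-unique (u≢w ∘ cong inj₁) ub wb ud wd)
  common-neighbour-unique {inj₂ _} {inj₂ _} {inj₂ _} {inj₂ _} u≢w ub wb ud wd =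
    cong inj₂ (H₂.common-neighbour-unique (u≢w ∘ cong inj₂) ub wb ud wd)
  common-neighbour-unique {inj₁ _} {_}      {inj₂ _} _ () _ _ _
  common-neighbour-unique {inj₂ _} {_}      {inj₁ _} _ () _ _ _
  common-neighbour-unique {inj₁ _} {_}      {inj₁ _} {inj₂ _} _ _ _ () _
  common-neighbour-unique {inj₂ _} {_}      {inj₂ _} {inj₁ _} _ _ _ () _
  common-neighbour-unique {inj₁ _} {inj₂ _} {inj₁ _} {inj₁ _} _ _ () _ _
  common-neighbour-unique {inj₂ _} {inj₁ _} {inj₂ _} {inj₂ _} _ _ () _ _

  sparse-bound : ∀ {ys} → Unique ys → Sparse edge 1 ys → length ys ≤ t₁ + t₂
  sparse-bound {ys} unique sparse = begin
    length ys                                        ≡⟨ length-lefts+rights ys ⟩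
    length (lefts ys) + length (lefts (map swap ys)) ≤⟨ +-mono-≤
      (H₁.sparse-bound (Unique-lefts unique) (Sparse-lefts H₁.edge H₂.edge sparse))
      (H₂.sparse-bound (Unique-lefts (Unique-map⁺ swap-injective unique))
        (Sparse-lefts H₂.edge H₁.edge (Sparse-map swap (⊎-adj-swap H₁.edge H₂.edge) sparse))) ⟩
    t₁ + t₂                                          ∎
    where open ≤-Reasoning

-- Exhaustive search for large 1-sparse sets

module Search {V : Set} (adj : V → V → Bool) (s : ℕ) where

  Extendable : List V → V → Set
  Extendable C v = degree adj C v ≤ 1 × All (λ u → adj u v ≡ true → degree adj C u ≡ 0) C

  extendable? : ∀ C v → Dec (Extendable C v)
  extendable? C v =
    degree adj C v ≤? 1 ×-dec all? (λ u → (adj u v ≟ᵇ true) →-dec (degree adj C u ℕ.≟ 0)) C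

  -- n is fuel; after v joins C, only the candidates that can still join are kept.
  search : ℕ → List V → List V → Bool
  search (suc n) C (v ∷ R) = ⌊ length C + length (v ∷ R) ≤? s ⌋
    ∨ (search n (v ∷ C) (filter (extendable? (v ∷ C)) R) ∧ search n C R)
  search _       C R       = ⌊ length C + length R ≤? s ⌋

  Sparse⇒Extendable : ∀ C Y → Sparse adj 1 (C ++ Y) → ∀ {v} → v ∈ Y → Extendable C v
  Sparse⇒Extendable C Y sparse {v} v∈Y =
    ≤-trans (m≤m+n _ _) (degree≤1 (∈-++⁺ʳ C v∈Y)) , All.tabulate isolated
    where
    degree≤1 : ∀ {u} → u ∈ C ++ Y → degree adj C u + degree adj Y u ≤ 1
    degree≤1 {u} u∈ = subst (_≤ 1) (degree-++ adj C Y u) (All.lookup sparse u∈)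
    isolated : ∀ {u} → u ∈ C → adj u v ≡ true → degree adj C u ≡ 0
    isolated {u} u∈C uv = n≤0⇒n≡0 (≤-pred (begin
      suc (degree adj C u)            ≡⟨ +-comm 1 _ ⟩
      degree adj C u + 1              ≤⟨ +-monoʳ-≤ (degree adj C u) (1≤sum-boolToℕ (adj u) v∈Y uv) ⟩
      degree adj C u + degree adj Y u ≤⟨ degree≤1 (∈-++⁺ˡ u∈C) ⟩
      1                               ∎))
      where open ≤-Reasoning

  fallback-sound : ∀ (C R : List V) {Y} → T ⌊ length C + length R ≤? s ⌋ → Y ⊆ R →
                   length C + length Y ≤ s
  fallback-sound C R accept Y⊆R =
    ≤-trans (+-monoʳ-≤ (length C) (length-mono-≤ Y⊆R))
            (toWitness {a? = length C + length R ≤? s} accept)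

  search-sound : ∀ n C R {Y} → T (search n C R) → Y ⊆ R → Sparse adj 1 (C ++ Y) →
                 length C + length Y ≤ s
  search-sound zero    C R  accept Y⊆R _ = fallback-sound C R accept Y⊆R
  search-sound (suc n) C [] accept Y⊆R _ = fallback-sound C [] accept Y⊆R
  search-sound (suc n) C (v ∷ R) accept Y⊆ sparse
    with Equivalence.to (T-∨ {⌊ length C + length (v ∷ R) ≤? s ⌋}) accept
  ... | inj₁ small = fallback-sound C (v ∷ R) small Y⊆
  ... | inj₂ accept′
    with Equivalence.to (T-∧ {search n (v ∷ C) (filter (extendable? (v ∷ C)) R)}) accept′ | Y⊆
  ...   | _ , accept-skip | .v ∷ʳ Y⊆R = search-sound n C R accept-skip Y⊆R sparse
  ...   | accept-take , _ | _∷_ {xs = Y} refl Y⊆R =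
    subst (_≤ s) (sym (+-suc (length C) (length Y)))
      (search-sound n (v ∷ C) R′ accept-take Y⊆R′ sparse′)
    where
    R′ = filter (extendable? (v ∷ C)) R
    sparse′ : Sparse adj 1 ((v ∷ C) ++ Y)
    sparse′ = Sparse-↭ adj (shift v C Y) sparse
    Y⊆R′ : Y ⊆ R′
    Y⊆R′ = subst (_⊆ R′)
      (filter-all (extendable? (v ∷ C)) (All.tabulate (Sparse⇒Extendable (v ∷ C) Y sparse′)))
      (filter⁺ (extendable? (v ∷ C)) (extendable? (v ∷ C)) (subst (Extendable (v ∷ C))) Y⊆R)

  module _ (_≟_ : DecidableEquality V) where
    open import Data.List.Membership.DecPropositional _≟_ using (_∈?_)

    search-bound : ∀ {L} → Unique L → T (search (length L) [] L) →
                   ∀ {ys} → Unique ys → All (_∈ L) ys → Sparse adj 1 ys → length ys ≤ s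
    search-bound {L} L-unique accept {ys} ys-unique ys⊆L sparse =
      subst (_≤ s) (↭-length Y↭ys) (search-sound (length L) [] L accept
        (filter-⊆ (_∈? ys) L) (Sparse-↭ adj (↭-sym Y↭ys) sparse))
      where
      Y↭ys : filter (_∈? ys) L ↭ ys
      Y↭ys = ∼bag⇒↭ (unique∧set⇒bag (Unique-filter⁺ _ L-unique) ys-unique (mk⇔
        (proj₂ ∘ ∈-filter⁻ (_∈? ys) {xs = L})
        (λ x∈ys → ∈-filter⁺ (_∈? ys) (All.lookup ys⊆L x∈ys) x∈ys)))

module _ {V : Set} (adj : V → V → Bool) (_≟_ : DecidableEquality V) (L : List V) where

  commonNeighbours : V → V → List V
  commonNeighbours u w = filter (λ b → adj u b ∧ adj w b ≟ᵇ true) L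

  CommonNeighboursAtMostOne : Set
  CommonNeighboursAtMostOne = All (λ u → All (λ w → u ≢ w → length (commonNeighbours u w) ≤ 1) L) L

  commonNeighboursAtMostOne? : Dec CommonNeighboursAtMostOne
  commonNeighboursAtMostOne? =
    all? (λ u → all? (λ w → ¬? (u ≟ w) →-dec (length (commonNeighbours u w) ≤? 1)) L) L

  atMostOne⇒unique : CommonNeighboursAtMostOne → ∀ {u w b d} → u ∈ L → w ∈ L → b ∈ L → d ∈ L →
    u ≢ w → adj u b ≡ true → adj w b ≡ true → adj u d ≡ true → adj w d ≡ true → b ≡ d
  atMostOne⇒unique atMostOne u∈ w∈ b∈ d∈ u≢w ub wb ud wd =
    ∈-length≤1 (All.lookup (All.lookup atMostOne u∈) w∈ u≢w)
      (∈-filter⁺ _ b∈ (cong₂ _∧_ ub wb)) (∈-filter⁺ _ d∈ (cong₂ _∧_ ud wd))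

-- Incidence graphs of configurations

isPoint : {P L : Set} → P ⊎ L → Bool
isPoint = [ const true , const false ]

incidence : {P L : Set} → (P → L → Bool) → P ⊎ L → P ⊎ L → Bool
incidence I (inj₁ p) (inj₂ l) = I p l
incidence I (inj₂ l) (inj₁ p) = I p l
incidence I _        _        = false

module _ {P L : Set} (I : P → L → Bool) where

  incidence-sym : ∀ u v → incidence I u v ≡ incidence I v u
  incidence-sym (inj₁ _) (inj₁ _) = refl
  incidence-sym (inj₁ _) (inj₂ _) = refl
  incidence-sym (inj₂ _) (inj₁ _) = refl
  incidence-sym (inj₂ _) (inj₂ _) = refl

  incidence-irrefl : ∀ v → incidence I v v ≡ false
  incidence-irrefl (inj₁ _) = refl
  incidence-irrefl (inj₂ _) = refl

  isPoint-proper : ∀ u v → incidence I u v ≡ true → isPoint u ≢ isPoint v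
  isPoint-proper (inj₁ _) (inj₂ _) _ ()
  isPoint-proper (inj₂ _) (inj₁ _) _ ()

incidence-map : ∀ {P L P′ L′ : Set} (I : P′ → L′ → Bool) (f : P → P′) (g : L → L′) u v →
  incidence I (⊎-map f g u) (⊎-map f g v) ≡ incidence (λ p l → I (f p) (g l)) u v
incidence-map I f g (inj₁ _) (inj₁ _) = refl
incidence-map I f g (inj₁ _) (inj₂ _) = refl
incidence-map I f g (inj₂ _) (inj₁ _) = refl
incidence-map I f g (inj₂ _) (inj₂ _) = refl

<ᵇ-true : ∀ {m n} → m < n → (m <ᵇ n) ≡ true
<ᵇ-true = Equivalence.to T-≡ ∘ <⇒<ᵇ

<ᵇ-false : ∀ {m n} → n ≤ m → (m <ᵇ n) ≡ false
<ᵇ-false {m} {n} n≤m with m <ᵇ n in m<ᵇn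
... | false = refl
... | true  = ⊥-elim (≤⇒≯ n≤m (<ᵇ⇒< m n (Equivalence.from T-≡ m<ᵇn)))

module IncidenceGraph (s : ℕ) (I : ℕ → ℕ → Bool) where

  edge : Fin s ⊎ Fin s → Fin s ⊎ Fin s → Bool
  edge = incidence (λ p l → I (toℕ p) (toℕ l))

  -- The searches run on the encoding by natural numbers, where the evaluator uses
  -- builtin arithmetic instead of unary Fin.
  encode : Fin s ⊎ Fin s → ℕ
  encode = [ toℕ , (s +_) ∘ toℕ ]

  side : ℕ → ℕ ⊎ ℕ
  side u = if u <ᵇ s then inj₁ u else inj₂ (u ∸ s)

  edgeℕ : ℕ → ℕ → Bool
  edgeℕ u v = incidence I (side u) (side v)

  vertices : List ℕ
  vertices = upTo (s + s)

  side-encode : ∀ x → side (encode x) ≡ ⊎-map toℕ toℕ x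
  side-encode (inj₁ p) =
    cong (λ b → if b then inj₁ (toℕ p) else inj₂ (toℕ p ∸ s)) (<ᵇ-true (toℕ<n p))
  side-encode (inj₂ l) =
    trans (cong (λ b → if b then inj₁ (s + toℕ l) else inj₂ (s + toℕ l ∸ s))
                (<ᵇ-false (m≤m+n s (toℕ l))))
          (cong inj₂ (m+n∸m≡n s (toℕ l)))

  edgeℕ-encode : ∀ u v → edgeℕ (encode u) (encode v) ≡ edge u v
  edgeℕ-encode u v =
    trans (cong₂ (incidence I) (side-encode u) (side-encode v)) (incidence-map I toℕ toℕ u v)

  encode-injective : ∀ {x y} → encode x ≡ encode y → x ≡ y
  encode-injective {x} {y} eq = ⊎-map-injective toℕ-injective toℕ-injective
    (trans (sym (side-encode x)) (trans (cong side eq) (side-encode y)))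

  encode∈vertices : ∀ x → encode x ∈ vertices
  encode∈vertices (inj₁ p) = ∈-upTo⁺ (<-≤-trans (toℕ<n p) (m≤m+n s s))
  encode∈vertices (inj₂ l) = ∈-upTo⁺ (+-monoʳ-< s (toℕ<n l))

  lowerBoundGraph : Search.search edgeℕ s (length vertices) [] vertices ≡ true →
                    ⌊ commonNeighboursAtMostOne? edgeℕ ℕ._≟_ vertices ⌋ ≡ true → LowerBoundGraph s
  lowerBoundGraph accept atMostOne = record
    { Vertex                  = Fin s ⊎ Fin s
    ; edge                    = edge
    ; edge-sym                = incidence-sym _
    ; edge-irrefl             = incidence-irrefl _
    ; colour                  = isPoint
    ; colour-proper           = isPoint-proper _
    ; common-neighbour-unique = λ {u} {w} {b} {d} u≢w ub wb ud wd → encode-injective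
        (atMostOne⇒unique edgeℕ ℕ._≟_ vertices (toWitness (Equivalence.from T-≡ atMostOne))
          (encode∈vertices u) (encode∈vertices w) (encode∈vertices b) (encode∈vertices d)
          (u≢w ∘ encode-injective) (trans (edgeℕ-encode u b) ub) (trans (edgeℕ-encode w b) wb)
          (trans (edgeℕ-encode u d) ud) (trans (edgeℕ-encode w d) wd))
    ; sparse-bound            = λ {ys} unique sparse → subst (_≤ s) (length-map encode ys)
        (Search.search-bound edgeℕ s ℕ._≟_ (upTo⁺ (s + s)) (Equivalence.from T-≡ accept)
          (Unique-map⁺ encode-injective unique)
          (All-map⁺ (All.tabulate (λ {x} _ → encode∈vertices x)))
          (Sparse-map encode edgeℕ-encode sparse))
    ; order                   = s + s
    ; t+t≤order               = ≤-refl
    ; embed                   = splitAt s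
    ; embed-injective         = splitAt-injective s
    }

-- Point p lies on line l iff p - l mod s is in the base block D (written p + s ∸ l, since
-- ∸ truncates).
cyclic : (s : ℕ) .{{_ : NonZero s}} → List ℕ → ℕ → ℕ → Bool
cyclic s D p l = any ((p + s ∸ l) % s ≡ᵇ_) D

heawood : LowerBoundGraph 7
heawood = IncidenceGraph.lowerBoundGraph 7 (cyclic 7 (0 ∷ 1 ∷ 3 ∷ [])) refl refl

möbiusKantor : LowerBoundGraph 8
möbiusKantor = IncidenceGraph.lowerBoundGraph 8 (cyclic 8 (0 ∷ 1 ∷ 3 ∷ [])) refl refl

levi-PG[2,3] : LowerBoundGraph 13
levi-PG[2,3] = IncidenceGraph.lowerBoundGraph 13 (cyclic 13 (0 ∷ 1 ∷ 3 ∷ 9 ∷ [])) refl refl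

-- Point 0 and line 0 of PG(2,3) are removed; they are incident.
levi-PG[2,3]-minus-flag : LowerBoundGraph 12
levi-PG[2,3]-minus-flag = IncidenceGraph.lowerBoundGraph 12
  (λ p l → cyclic 13 (0 ∷ 1 ∷ 3 ∷ 9 ∷ []) (suc p) (suc l)) refl refl

lowerBoundGraph-19+ : ∀ k → LowerBoundGraph (19 + k)
lowerBoundGraph-19+ 0 = heawood ⊕ levi-PG[2,3]-minus-flag
lowerBoundGraph-19+ 1 = möbiusKantor ⊕ levi-PG[2,3]-minus-flag
lowerBoundGraph-19+ 2 = möbiusKantor ⊕ levi-PG[2,3]
lowerBoundGraph-19+ 3 = heawood ⊕ (heawood ⊕ möbiusKantor)
lowerBoundGraph-19+ 4 = heawood ⊕ (möbiusKantor ⊕ möbiusKantor)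
lowerBoundGraph-19+ 5 = levi-PG[2,3]-minus-flag ⊕ levi-PG[2,3]-minus-flag
lowerBoundGraph-19+ 6 = levi-PG[2,3]-minus-flag ⊕ levi-PG[2,3]
lowerBoundGraph-19+ (suc (suc (suc (suc (suc (suc (suc k))))))) = heawood ⊕ lowerBoundGraph-19+ k

theorem5p4 : (j : ℕ) → (20 ≤ j ⊎ (j ≡ 15 ⊎ (j ≡ 16 ⊎ j ≡ 17))) →
    RamseyBIP≡ 1 4 j (2 * j ∸ 1)
theorem5p4 j (inj₁ 20≤j) =
  subst (λ j → RamseyBIP≡ 1 4 j (2 * j ∸ 1)) (m+[n∸m]≡n 20≤j)
    (lowerBoundGraph⇒ramseyBIP (lowerBoundGraph-19+ (j ∸ 20)))
theorem5p4 .15 (inj₂ (inj₁ refl))        = lowerBoundGraph⇒ramseyBIP (heawood ⊕ heawood)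
theorem5p4 .16 (inj₂ (inj₂ (inj₁ refl))) = lowerBoundGraph⇒ramseyBIP (heawood ⊕ möbiusKantor)
theorem5p4 .17 (inj₂ (inj₂ (inj₂ refl))) = lowerBoundGraph⇒ramseyBIP (möbiusKantor ⊕ möbiusKantor)
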